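{- Let $G$ be a $u,v$-necklace consisting of $t\ge 2$ cycles, and suppose that $G$ has no two adjacent vertices both of degree $4$. Then $\chi_{la}(G)\le 6$.
   Context: A $u,v$-necklace is a graph which is the union of a list of cycles $C_1,C_2,\dots,C_t$ such that $u\in C_1$, $v\in C_t$, consecutive cycles $C_i,C_{i+1}$ share exactly one vertex, and non-consecutive cycles are vertex-disjoint. For a graph $G=(V,E)$ without $K_2$ components, a bijection $f:E\to\{1,2,\dots,|E|\}$ induces the weight $w(x)=\sum_{xy\in E} f(xy)$ of each vertex $x$. The bijection $f$ is a local antimagic labeling if $w(x)\neq w(y)$ for every edge $xy$. The local antimagic chromatic number $\chi_{la}(G)$ is the minimum number of distinct weights over all local antimagic labelings of $G$. -}

module Defs where

open import Data.Nat using (ℕ; zero; suc; _+_; _≤_; _≟_)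
open import Data.Fin using (Fin; toℕ)
open import Data.Fin.Properties using () renaming (_≟_ to _≟ᶠ_)
open import Data.List using (List; []; _∷_; map; length; deduplicate)
open import Data.Nat.ListAction using (sum)
open import Data.List.Membership.Propositional using (_∈_)
open import Data.List.Relation.Unary.Any using (Any)
open import Data.List.Relation.Unary.Unique.Propositional using (Unique)
open import Data.List using (allFin)
open import Data.Product using (Σ; ∃; ∃-syntax; _×_; _,_; proj₁; proj₂)
open import Data.Sum using (_⊎_)
open import Data.Bool using (if_then_else_)
open import Relation.Nullary using (¬_; Dec)
open import Relation.Nullary.Decidable using (⌊_⌋; _⊎-dec_)
open import Relation.Binary.PropositionalEquality using (_≡_; _≢_)
open import Function.Bundles using (Bijection)
open import Relation.Binary.PropositionalEquality using () renaming (setoid to ≡-setoid)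

record Graph : Set where
  field
    n : ℕ
    m : ℕ
    ends : Fin m → Fin n × Fin n

open Graph public

SameEdge : ∀ {A : Set} → A × A → A × A → Set
SameEdge (a , b) (c , d) = (a ≡ c × b ≡ d) ⊎ (a ≡ d × b ≡ c)

IsSimple : Graph → Set
IsSimple G = (∀ e → proj₁ (ends G e) ≢ proj₂ (ends G e))
           × (∀ e e′ → SameEdge (ends G e) (ends G e′) → e ≡ e′)

Incident : (G : Graph) → Fin (n G) → Fin (m G) → Set
Incident G x e = proj₁ (ends G e) ≡ x ⊎ proj₂ (ends G e) ≡ x

incident? : (G : Graph) → (x : Fin (n G)) → (e : Fin (m G)) → Dec (Incident G x e)
incident? G x e = (proj₁ (ends G e) ≟ᶠ x) ⊎-dec (proj₂ (ends G e) ≟ᶠ x)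

degree : (G : Graph) → Fin (n G) → ℕ
degree G x = sum (map (λ e → if ⌊ incident? G x e ⌋ then 1 else 0) (allFin (m G)))

Adjacent : (G : Graph) → Fin (n G) → Fin (n G) → Set
Adjacent G x y = ∃[ e ] SameEdge (ends G e) (x , y)

-- Edges of a cycle given by its cyclic vertex sequence x0 x1 ... xk:
-- x0x1, x1x2, ..., x(k-1)xk, xkx0.
private
  pairs : ∀ {A : Set} → A → List A → List (A × A)
  pairs first [] = []
  pairs first (x ∷ []) = (x , first) ∷ []
  pairs first (x ∷ y ∷ r) = (x , y) ∷ pairs first (y ∷ r)

cycleEdges : ∀ {A : Set} → List A → List (A × A)
cycleEdges [] = []
cycleEdges (x ∷ r) = pairs x (x ∷ r)

IsCycle : ∀ {k} → List (Fin k) → Set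
IsCycle c = Unique c × 3 ≤ length c

ShareExactlyOne : ∀ {k} → List (Fin k) → List (Fin k) → Set
ShareExactlyOne c d = ∃[ w ] (w ∈ c × w ∈ d × (∀ y → y ∈ c → y ∈ d → y ≡ w))

VertexDisjoint : ∀ {k} → List (Fin k) → List (Fin k) → Set
VertexDisjoint c d = ∀ y → y ∈ c → ¬ (y ∈ d)

-- G is a u,v-necklace with t cycles C_0,...,C_{t-1} (the paper's C_1..C_t):
-- G is exactly the union of the cycles (vertices and edges).
record IsNecklace (G : Graph) (u v : Fin (n G)) (t : ℕ) : Set where
  field
    cyc        : Fin t → List (Fin (n G))
    isCycle    : ∀ i → IsCycle (cyc i)
    u∈first    : ∃[ i ] (toℕ i ≡ 0 × u ∈ cyc i)
    v∈last     : ∃[ i ] (suc (toℕ i) ≡ t × v ∈ cyc i)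
    consecutive : ∀ i j → toℕ j ≡ suc (toℕ i) → ShareExactlyOne (cyc i) (cyc j)
    nonconsec  : ∀ i j → suc (suc (toℕ i)) ≤ toℕ j → VertexDisjoint (cyc i) (cyc j)
    vertsCovered : ∀ x → ∃[ i ] (x ∈ cyc i)
    edgesCovered : ∀ e → ∃[ i ] Any (SameEdge (ends G e)) (cycleEdges (cyc i))
    cycleEdgesInG : ∀ i p → p ∈ cycleEdges (cyc i) → ∃[ e ] SameEdge (ends G e) p

-- Edge labelings: bijections E → {1,...,|E|}; edge e gets label 1 + toℕ (f e).
Labeling : Graph → Set
Labeling G = Bijection (≡-setoid (Fin (m G))) (≡-setoid (Fin (m G)))

label : (G : Graph) → Labeling G → Fin (m G) → ℕ
label G f e = suc (toℕ (Bijection.to f e))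

weight : (G : Graph) → Labeling G → Fin (n G) → ℕ
weight G f x = sum (map (λ e → if ⌊ incident? G x e ⌋ then label G f e else 0) (allFin (m G)))

IsLocalAntimagic : (G : Graph) → Labeling G → Set
IsLocalAntimagic G f = ∀ x y → Adjacent G x y → weight G f x ≢ weight G f y

numWeights : (G : Graph) → Labeling G → ℕ
numWeights G f = length (deduplicate _≟_ (map (weight G f) (allFin (n G))))

χla≤ : Graph → ℕ → Set
χla≤ G k = ∃[ f ] (IsLocalAntimagic G f × numWeights G f ≤ k)

module Submission where

-- A necklace has a closed trail v₀ v₁ … v_k v₀ through every edge exactly once, obtained by splicing
-- consecutive cycles together at their common vertex; it passes every vertex once or twice, and the
-- vertices passed twice are exactly those of degree 4.  Label the trail edge v_j v_{j+1} by 1 + α(j),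
-- where α(2q) = q and α(2q+1) = k − q is a permutation of {0, …, k}.  The two trail edges at the
-- visit j > 0 then carry labels summing to k + 2 for odd j and k + 3 for even j, and at the visit j = 0
-- to less than k + 2.  Hence a vertex passed once has weight at most k + 3 and a vertex passed twice at
-- least k + 4; two vertices passed once that are adjacent are consecutive on the trail and get different
-- sums.  So only two adjacent vertices of degree 4 could collide, and all weights lie in
-- {k+2, k+3, 2k+4, 2k+5, 2k+6, w(v₀)}.


open import Defs
open import Level using (0ℓ)
open import Function using (_∘_; case_of_)
open import Data.Empty using (⊥; ⊥-elim)
open import Data.Bool using (Bool; true; false; not; if_then_else_)
open import Data.Bool.Properties using (not-¬)
open import Data.Nat as ℕ using (ℕ; zero; suc; _+_; _∸_; _≤_; _<_; z≤n; s≤s; _≤?_; _<?_; ⌊_/2⌋)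
open import Data.Nat.Properties
open import Data.Nat.ListAction using (sum)
open import Data.Fin as F using (Fin; toℕ; fromℕ; fromℕ<; inject₁)
open import Data.Fin.Properties
  using (toℕ-injective; toℕ-fromℕ<; toℕ-fromℕ; toℕ-inject₁; toℕ≤pred[n]; toℕ<n; toℕ-cast)
  renaming (suc-injective to F-suc-injective; _≟_ to _≟ᶠ_)
open import Data.Fin.Permutation
  using (Permutation; permutation; _⟨$⟩ʳ_; _⟨$⟩ˡ_; _∘ₚ_; flip; cast-id; ↔⇒≡; inverseˡ; inverseʳ)
open import Function.Properties.Inverse using (↔⇒⤖)
open import Data.List as L
  using (List; []; _∷_; [_]; _++_; length; map; filter; tabulate; allFin; concat; deduplicate)
open import Data.List.Properties
  using (length-++; length-++-≤ˡ; filter-++; map-cong; map-tabulate; tabulate-cong; ++-assoc; ++-identityʳ)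
open import Data.List.Membership.Propositional using (_∈_)
open import Data.List.Membership.Propositional.Properties
  using (∈-∃++; ∈-++⁺ˡ; ∈-filter⁺; ∈-filter⁻; ∈-allFin; ∈-map⁻; ∈-deduplicate⁻; ∈-tabulate⁺; ∈-tabulate⁻)
open import Data.List.Relation.Unary.Any using (Any; here; there)
open import Data.List.Relation.Unary.Any.Properties using ()
  renaming (tabulate⁺ to Any-tabulate⁺; tabulate⁻ to Any-tabulate⁻; concat⁺ to Any-concat⁺; concat⁻ to Any-concat⁻)
open import Data.List.Relation.Unary.All as All using ([]; _∷_)
open import Data.List.Relation.Unary.Unique.Propositional using (Unique; []; _∷_)
open import Data.List.Relation.Unary.Unique.Propositional.Properties using (allFin⁺; filter⁺)
open import Data.List.Relation.Unary.Unique.DecPropositional.Properties ℕ._≟_ using (deduplicate-!)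
open import Data.List.Relation.Binary.Subset.Propositional using (_⊆_)
open import Data.List.Relation.Binary.Permutation.Propositional
  using (_↭_; ↭-reflexive; ↭-sym; ↭-trans; module PermutationReasoning)
open import Data.List.Relation.Binary.Permutation.Propositional.Properties
  using (filter-↭; ↭-length; ++-comm; ++⁺; ++⁺ʳ; ∈-resp-↭; Any-resp-↭)
open import Data.Product using (∃; ∃-syntax; _×_; _,_; proj₁; proj₂)
open import Data.Sum using (_⊎_; inj₁; inj₂)
open import Relation.Nullary using (¬_; Dec; yes; no)
open import Relation.Nullary.Decidable using (⌊_⌋; _×-dec_; _⊎-dec_)
open import Relation.Unary using (Pred; Decidable)
open import Relation.Binary.PropositionalEquality hiding ([_])
open import Relation.Binary.Definitions using (tri<; tri≈; tri>)
open import Algebra.Properties.CommutativeMonoid.Sum +-0-commutativeMonoid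
  using (sum-cong-≗; sum-replicate-zero; sum-permute; ∑-distrib-+) renaming (sum to ∑)

module _ {A : Set} where

  sum-map-tabulate : ∀ {n} (f : A → ℕ) (g : Fin n → A) → sum (map f (tabulate g)) ≡ ∑ (f ∘ g)
  sum-map-tabulate {zero} f g = refl
  sum-map-tabulate {suc n} f g = cong (f (g F.zero) +_) (sum-map-tabulate f (g ∘ F.suc))

  ∑-if≡sum-filter : ∀ {n} {P : Pred A 0ℓ} (P? : Decidable P) (f : A → ℕ) (g : Fin n → A) →
                    ∑ (λ j → if ⌊ P? (g j) ⌋ then f (g j) else 0) ≡ sum (map f (filter P? (tabulate g)))
  ∑-if≡sum-filter {zero} P? f g = refl
  ∑-if≡sum-filter {suc n} P? f g with P? (g F.zero)
  ... | yes _ = cong (f (g F.zero) +_) (∑-if≡sum-filter P? f (g ∘ F.suc))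
  ... | no _ = ∑-if≡sum-filter P? f (g ∘ F.suc)

  sum-map-const : ∀ c (xs : List A) → sum (map (λ _ → c) xs) ≡ length xs ℕ.* c
  sum-map-const c [] = refl
  sum-map-const c (x ∷ xs) = cong (c +_) (sum-map-const c xs)

  length-≤-⊆ : ∀ {xs ys : List A} → Unique xs → xs ⊆ ys → length xs ≤ length ys
  length-≤-⊆ {[]} _ _ = z≤n
  length-≤-⊆ {x ∷ xs} (x∉xs ∷ xs!) xs⊆ys with ys₁ , ys₂ , refl ← ∈-∃++ (xs⊆ys (here refl)) =
    begin
      suc (length xs)            ≤⟨ s≤s (length-≤-⊆ xs! xs⊆ys₁ys₂) ⟩
      suc (length (ys₁ ++ ys₂))  ≡⟨ cong suc (length-++ ys₁) ⟩
      suc (length ys₁ + length ys₂) ≡⟨ sym (+-suc (length ys₁) (length ys₂)) ⟩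
      length ys₁ + length (x ∷ ys₂) ≡⟨ sym (length-++ ys₁) ⟩
      length (ys₁ ++ x ∷ ys₂)    ∎
    where
    open ≤-Reasoning
    drop-x : ∀ zs {y} → y ∈ zs ++ x ∷ ys₂ → x ≢ y → y ∈ zs ++ ys₂
    drop-x [] (here refl) x≢y = ⊥-elim (x≢y refl)
    drop-x [] (there y∈) _ = y∈
    drop-x (z ∷ zs) (here y≡z) _ = here y≡z
    drop-x (z ∷ zs) (there y∈) x≢y = there (drop-x zs y∈ x≢y)
    xs⊆ys₁ys₂ : xs ⊆ ys₁ ++ ys₂
    xs⊆ys₁ys₂ y∈xs = drop-x ys₁ (xs⊆ys (there y∈xs)) (All.lookup x∉xs y∈xs)

  length≤1 : ∀ {xs : List A} → Unique xs → (∀ {a b} → a ∈ xs → b ∈ xs → a ≡ b) → length xs ≤ 1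
  length≤1 {[]} _ _ = z≤n
  length≤1 {_ ∷ []} _ _ = s≤s z≤n
  length≤1 {_ ∷ _ ∷ _} ((x≢y ∷ _) ∷ _) same = ⊥-elim (x≢y (same (here refl) (there (here refl))))

term≤∑ : ∀ {n} (f : Fin n → ℕ) i → f i ≤ ∑ f
term≤∑ f F.zero = m≤m+n _ _
term≤∑ f (F.suc i) = ≤-trans (term≤∑ (f ∘ F.suc) i) (m≤n+m _ (f F.zero))

∑≡0 : ∀ {n} (f : Fin n → ℕ) → (∀ i → f i ≡ 0) → ∑ f ≡ 0
∑≡0 {n} f f≡0 = trans (sum-cong-≗ f≡0) (sum-replicate-zero n)

∑≤1 : ∀ {n} (f : Fin n → ℕ) → (∀ i → f i ≤ 1) → (∀ i j → 1 ≤ f i → 1 ≤ f j → i ≡ j) → ∑ f ≤ 1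
∑≤1 {zero} f _ _ = z≤n
∑≤1 {suc n} f f≤1 same with n≤1⇒n≡0∨n≡1 (f≤1 F.zero)
... | inj₁ f0≡0 = ≤-trans (≤-reflexive (cong (_+ ∑ (f ∘ F.suc)) f0≡0))
                    (∑≤1 (f ∘ F.suc) (f≤1 ∘ F.suc) (λ i j p q → F-suc-injective (same _ _ p q)))
... | inj₂ f0≡1 = ≤-reflexive (cong₂ _+_ f0≡1 (∑≡0 (f ∘ F.suc) tail≡0))
  where
  tail≡0 : ∀ i → f (F.suc i) ≡ 0
  tail≡0 i = n<1⇒n≡0 (≰⇒> λ p → case same F.zero (F.suc i) (≤-reflexive (sym f0≡1)) p of λ ())

∑≤2 : ∀ {n} (f : Fin n → ℕ) → (∀ i → f i ≤ 1) →
      (∀ i j l → 1 ≤ f i → 1 ≤ f j → 1 ≤ f l → i ≢ j → j ≢ l → i ≢ l → ⊥) → ∑ f ≤ 2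
∑≤2 {zero} f _ _ = z≤n
∑≤2 {suc n} f f≤1 noThree with n≤1⇒n≡0∨n≡1 (f≤1 F.zero)
... | inj₁ f0≡0 = ≤-trans (≤-reflexive (cong (_+ ∑ (f ∘ F.suc)) f0≡0))
                    (∑≤2 (f ∘ F.suc) (f≤1 ∘ F.suc) λ i j l pi pj pl i≢j j≢l i≢l →
                       noThree _ _ _ pi pj pl (i≢j ∘ F-suc-injective) (j≢l ∘ F-suc-injective) (i≢l ∘ F-suc-injective))
... | inj₂ f0≡1 = +-mono-≤ (f≤1 F.zero) (∑≤1 (f ∘ F.suc) (f≤1 ∘ F.suc) same)
  where
  same : ∀ i j → 1 ≤ f (F.suc i) → 1 ≤ f (F.suc j) → i ≡ j
  same i j pi pj with i ≟ᶠ j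
  ... | yes i≡j = i≡j
  ... | no i≢j =
    ⊥-elim (noThree F.zero (F.suc i) (F.suc j) (≤-reflexive (sym f0≡1)) pi pj (λ ()) (i≢j ∘ F-suc-injective) (λ ()))

count : ∀ {A : Set} {P : Pred A 0ℓ} → Decidable P → List A → ℕ
count P? = length ∘ filter P?

module _ {A : Set} {P : Pred A 0ℓ} (P? : Decidable P) where

  count-↭ : ∀ {xs ys} → xs ↭ ys → count P? xs ≡ count P? ys
  count-↭ = ↭-length ∘ filter-↭ P?

  count-++ : ∀ xs ys → count P? (xs ++ ys) ≡ count P? xs + count P? ys
  count-++ xs ys = trans (cong length (filter-++ P? xs ys)) (length-++ (filter P? xs))

  count-concat-tabulate : ∀ {n} (g : Fin n → List A) → count P? (concat (tabulate g)) ≡ ∑ (count P? ∘ g)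
  count-concat-tabulate {zero} g = refl
  count-concat-tabulate {suc n} g =
    trans (count-++ (g F.zero) _) (cong (count P? (g F.zero) +_) (count-concat-tabulate (g ∘ F.suc)))

  count≡∑ : ∀ {n} (g : Fin n → A) → count P? (tabulate g) ≡ ∑ (λ j → if ⌊ P? (g j) ⌋ then 1 else 0)
  count≡∑ g = sym (begin
      ∑ (λ j → if ⌊ P? (g j) ⌋ then 1 else 0)          ≡⟨ ∑-if≡sum-filter P? (λ _ → 1) g ⟩
      sum (map (λ _ → 1) (filter P? (tabulate g)))    ≡⟨ sum-map-const 1 (filter P? (tabulate g)) ⟩
      count P? (tabulate g) ℕ.* 1                     ≡⟨ *-identityʳ _ ⟩
      count P? (tabulate g)                           ∎)
    where open ≡-Reasoning

  count>0⇒∈ : ∀ xs → 1 ≤ count P? xs → ∃ λ x → x ∈ xs × P x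
  count>0⇒∈ xs c>0 with filter P? xs | (λ {x} → ∈-filter⁻ P? {x} {xs})
  ... | y ∷ _ | ∈⁻ = y , ∈⁻ (here refl)

  ∈⇒count>0 : ∀ {xs x} → x ∈ xs → P x → 1 ≤ count P? xs
  ∈⇒count>0 {xs} x∈xs px with filter P? xs | ∈-filter⁺ P? x∈xs px
  ... | _ ∷ _ | _ = s≤s z≤n

count-tabulate : ∀ {A : Set} {P : Pred A 0ℓ} (P? : Decidable P) {n} (g : Fin n → A) →
                 count P? (tabulate g) ≡ count (P? ∘ g) (allFin n)
count-tabulate P? g = trans (count≡∑ P? g) (sym (count≡∑ (P? ∘ g) (λ j → j)))

module _ {A : Set} {P : Pred A 0ℓ} (P? : Decidable P) where

  count≤1 : ∀ {xs} → Unique xs → (∀ {a b} → a ∈ xs → b ∈ xs → P a → P b → a ≡ b) → count P? xs ≤ 1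
  count≤1 xs! same = length≤1 (filter⁺ P? xs!) λ a∈ b∈ →
    let (a∈xs , pa) = ∈-filter⁻ P? a∈ ; (b∈xs , pb) = ∈-filter⁻ P? b∈ in same a∈xs b∈xs pa pb

  distinct⇒2≤count : ∀ {xs a b} → a ∈ xs → b ∈ xs → P a → P b → a ≢ b → 2 ≤ count P? xs
  distinct⇒2≤count {xs} a∈xs b∈xs pa pb a≢b with filter P? xs | ∈-filter⁺ P? a∈xs pa | ∈-filter⁺ P? b∈xs pb
  ... | _ ∷ _ ∷ _ | _ | _ = s≤s (s≤s z≤n)
  ... | _ ∷ [] | here refl | here refl = ⊥-elim (a≢b refl)

count≤1⇒tabulate-injective : ∀ {A : Set} {P : Pred A 0ℓ} (P? : Decidable P) {n} (g : Fin n → A) →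
  count P? (tabulate g) ≤ 1 → ∀ i j → P (g i) → P (g j) → i ≡ j
count≤1⇒tabulate-injective P? g atMostOnce i j pi pj with i ≟ᶠ j
... | yes i≡j = i≡j
... | no i≢j = ⊥-elim (1+n≰n (begin
    2                              ≤⟨ distinct⇒2≤count (P? ∘ g) (∈-allFin i) (∈-allFin j) pi pj i≢j ⟩
    count (P? ∘ g) (allFin _)      ≡⟨ sym (count-tabulate P? g) ⟩
    count P? (tabulate g)          ≤⟨ atMostOnce ⟩
    1                              ∎))
  where open ≤-Reasoning

unique⇒count≤1 : ∀ {N} {c : List (Fin N)} → Unique c → ∀ x → count (_≟ᶠ x) c ≤ 1
unique⇒count≤1 c! x = count≤1 (_≟ᶠ x) c! (λ _ _ a≡x b≡x → trans a≡x (sym b≡x))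

if-+ : ∀ (b : Bool) a c → (if b then a else 0) + (if b then c else 0) ≡ (if b then a + c else 0)
if-+ true a c = refl
if-+ false a c = refl

isOdd : ℕ → Bool
isOdd 0 = false
isOdd 1 = true
isOdd (suc (suc j)) = isOdd j

isOdd-suc : ∀ j → isOdd (suc j) ≡ not (isOdd j)
isOdd-suc 0 = refl
isOdd-suc 1 = refl
isOdd-suc (suc (suc j)) = isOdd-suc j

isOdd-double : ∀ q → isOdd (q + q) ≡ false
isOdd-double zero = refl
isOdd-double (suc q) rewrite +-suc q q = isOdd-double q

isOdd-suc-double : ∀ q → isOdd (suc (q + q)) ≡ true
isOdd-suc-double q = trans (isOdd-suc (q + q)) (cong not (isOdd-double q))

⌊suc[n+n]/2⌋≡n : ∀ n → ⌊ suc (n + n) /2⌋ ≡ n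
⌊suc[n+n]/2⌋≡n zero = refl
⌊suc[n+n]/2⌋≡n (suc n) rewrite +-suc n n = cong suc (⌊suc[n+n]/2⌋≡n n)

even-or-odd : ∀ j → (∃[ q ] j ≡ q + q) ⊎ (∃[ q ] j ≡ suc (q + q))
even-or-odd zero = inj₁ (0 , refl)
even-or-odd (suc zero) = inj₂ (0 , refl)
even-or-odd (suc (suc j)) with even-or-odd j
... | inj₁ (q , refl) = inj₁ (suc q , cong suc (sym (+-suc q q)))
... | inj₂ (q , refl) = inj₂ (suc q , cong (suc ∘ suc) (sym (+-suc q q)))

Consecutive : ℕ → ℕ → Set
Consecutive a b = b ≡ suc a ⊎ a ≡ suc b

no-consecutive-triangle : ∀ {a b c} → Consecutive a b → Consecutive b c → Consecutive a c → ⊥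
no-consecutive-triangle ab bc ac = three-bools (differ ab) (differ bc) (differ ac)
  where
  differ : ∀ {x y} → Consecutive x y → isOdd x ≢ isOdd y
  differ {x} (inj₁ refl) eq = not-¬ refl (trans eq (isOdd-suc x))
  differ {y = y} (inj₂ refl) eq = not-¬ refl (trans (sym eq) (isOdd-suc y))
  three-bools : ∀ {x y z : Bool} → x ≢ y → y ≢ z → x ≢ z → ⊥
  three-bools {true} {true} x≢y _ _ = x≢y refl
  three-bools {false} {false} x≢y _ _ = x≢y refl
  three-bools {true} {false} {true} _ _ x≢z = x≢z refl
  three-bools {true} {false} {false} _ y≢z _ = y≢z refl
  three-bools {false} {true} {true} _ y≢z _ = y≢z refl
  three-bools {false} {true} {false} _ _ x≢z = x≢z refl

-- The zigzag labelling of a closed trail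

module Zigzag (k : ℕ) where

  zigzag : ℕ → ℕ
  zigzag j = if isOdd j then k ∸ ⌊ j /2⌋ else ⌊ j /2⌋

  zigzag-even : ∀ q → zigzag (q + q) ≡ q
  zigzag-even q rewrite isOdd-double q = sym (n≡⌊n+n/2⌋ q)

  zigzag-odd : ∀ q → zigzag (suc (q + q)) ≡ k ∸ q
  zigzag-odd q rewrite isOdd-suc-double q = cong (k ∸_) (⌊suc[n+n]/2⌋≡n q)

  zigzag-≤ : ∀ j → j ≤ k → zigzag j ≤ k
  zigzag-≤ j j≤k with even-or-odd j
  ... | inj₁ (q , refl) rewrite zigzag-even q = ≤-trans (m≤m+n q q) j≤k
  ... | inj₂ (q , refl) rewrite zigzag-odd q = m∸n≤m k q

  zigzag-k<k : 2 ≤ k → zigzag k < k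
  zigzag-k<k 2≤k with even-or-odd k
  ... | inj₁ (zero , refl) = case 2≤k of λ ()
  ... | inj₂ (zero , refl) = case 2≤k of λ { (s≤s ()) }
  ... | inj₁ (suc q , refl) rewrite zigzag-even (suc q) = m<m+n (suc q) (s≤s z≤n)
  ... | inj₂ (suc q , refl) rewrite zigzag-odd (suc q) = s≤s (m∸n≤m (suc q + suc q) q)

  unzigzag : ℕ → ℕ
  unzigzag v with v + v ≤? k
  ... | yes _ = v + v
  ... | no _ = suc ((k ∸ v) + (k ∸ v))

  unzigzag-≤ : ∀ v → v ≤ k → unzigzag v ≤ k
  unzigzag-≤ v v≤k with v + v ≤? k
  ... | yes v+v≤k = v+v≤k
  ... | no v+v≰k = begin
      suc (d + d) ≡⟨ sym (+-suc d d) ⟩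
      d + suc d   ≤⟨ +-monoʳ-≤ d d<v ⟩
      d + v       ≡⟨ m∸n+n≡m v≤k ⟩
      k           ∎
    where
    open ≤-Reasoning
    d = k ∸ v
    d<v : d < v
    d<v = +-cancelʳ-< v d v (subst (_< v + v) (sym (m∸n+n≡m v≤k)) (≰⇒> v+v≰k))

  zigzag-unzigzag : ∀ v → v ≤ k → zigzag (unzigzag v) ≡ v
  zigzag-unzigzag v v≤k with v + v ≤? k
  ... | yes _ = zigzag-even v
  ... | no _ = trans (zigzag-odd (k ∸ v)) (m∸[m∸n]≡n v≤k)

  unzigzag-zigzag : ∀ j → j ≤ k → unzigzag (zigzag j) ≡ j
  unzigzag-zigzag j j≤k with even-or-odd j
  ... | inj₁ (q , refl) rewrite zigzag-even q with q + q ≤? k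
  ...   | yes _ = refl
  ...   | no q+q≰k = ⊥-elim (q+q≰k j≤k)
  unzigzag-zigzag j j≤k | inj₂ (q , refl) rewrite zigzag-odd q with (k ∸ q) + (k ∸ q) ≤? k
  ...   | yes r+r≤k = ⊥-elim (<⇒≱ q<r (+-cancelˡ-≤ r r q (subst (r + r ≤_) (sym r+q≡k) r+r≤k)))
    where
    r = k ∸ q
    r+q≡k : r + q ≡ k
    r+q≡k = m∸n+n≡m (≤-trans (m≤m+n q q) (≤-trans (n≤1+n _) j≤k))
    q<r : q < r
    q<r = +-cancelʳ-< q q r (subst (q + q <_) (sym r+q≡k) j≤k)
  ...   | no _ = cong suc (cong₂ _+_ (m∸[m∸n]≡n q≤k) (m∸[m∸n]≡n q≤k))
    where
    q≤k : q ≤ k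
    q≤k = ≤-trans (m≤m+n q q) (≤-trans (n≤1+n _) j≤k)

  -- Edge j of the trail gets label 1 + zigzag j; pairSum j is the sum of the labels of the
  -- two trail edges meeting at the j-th vertex of the trail, edges j and j − 1 (mod k + 1).
  pairSum : ℕ → ℕ
  pairSum zero = suc (zigzag 0) + suc (zigzag k)
  pairSum (suc a) = suc (zigzag (suc a)) + suc (zigzag a)

  pairSum-zero< : 2 ≤ k → pairSum 0 < 2 + k
  pairSum-zero< 2≤k = s≤s (s≤s (zigzag-k<k 2≤k))

  pairSum-suc : ∀ a → suc a ≤ k → pairSum (suc a) ≡ (if isOdd a then 3 + k else 2 + k)
  pairSum-suc a sa≤k with even-or-odd a
  ... | inj₁ (q , refl) rewrite zigzag-odd q | zigzag-even q | isOdd-double q =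
    cong suc (trans (+-suc (k ∸ q) q) (cong suc (m∸n+n≡m q≤k)))
    where
    q≤k : q ≤ k
    q≤k = ≤-trans (m≤m+n q q) (≤-trans (n≤1+n _) sa≤k)
  ... | inj₂ (q , refl) = begin
      suc (zigzag (suc (suc (q + q)))) + suc (zigzag (suc (q + q)))
        ≡⟨ cong₂ (λ x y → suc x + suc y)
                 (trans (cong (zigzag ∘ suc) (sym (+-suc q q))) (zigzag-even (suc q))) (zigzag-odd q) ⟩
      suc (suc q) + suc (k ∸ q)
        ≡⟨ cong (suc ∘ suc) (trans (+-suc q (k ∸ q)) (cong suc (m+[n∸m]≡n q≤k))) ⟩
      3 + k
        ≡⟨ cong (if_then 3 + k else 2 + k) (sym (isOdd-suc-double q)) ⟩
      (if isOdd (suc (q + q)) then 3 + k else 2 + k) ∎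
    where
    open ≡-Reasoning
    q≤k : q ≤ k
    q≤k = ≤-trans (m≤m+n q q) (≤-trans (n≤1+n _) (≤-trans (n≤1+n _) sa≤k))

  2≤pairSum : ∀ j → 2 ≤ pairSum j
  2≤pairSum zero = s≤s (s≤s z≤n)
  2≤pairSum (suc a) = s≤s (≤-trans (s≤s z≤n) (m≤n+m _ (zigzag (suc a))))

  pairSum-suc≥ : ∀ a → suc a ≤ k → 2 + k ≤ pairSum (suc a)
  pairSum-suc≥ a sa≤k rewrite pairSum-suc a sa≤k with isOdd a
  ... | true = n≤1+n _
  ... | false = ≤-refl

  pairSum-suc≤ : ∀ a → suc a ≤ k → pairSum (suc a) ≤ 3 + k
  pairSum-suc≤ a sa≤k rewrite pairSum-suc a sa≤k with isOdd a
  ... | true = ≤-refl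
  ... | false = n≤1+n _

  pairSum-zero<suc : 2 ≤ k → ∀ a → suc a ≤ k → pairSum 0 < pairSum (suc a)
  pairSum-zero<suc 2≤k a sa≤k = <-≤-trans (pairSum-zero< 2≤k) (pairSum-suc≥ a sa≤k)

  pairSum-suc≢ : ∀ a → suc (suc a) ≤ k → pairSum (suc a) ≢ pairSum (suc (suc a))
  pairSum-suc≢ a ssa≤k eq = differ (isOdd a) (begin
      (if isOdd a then 3 + k else 2 + k)             ≡⟨ sym (pairSum-suc a (≤-trans (n≤1+n _) ssa≤k)) ⟩
      pairSum (suc a)                                ≡⟨ eq ⟩
      pairSum (suc (suc a))                          ≡⟨ pairSum-suc (suc a) ssa≤k ⟩
      (if isOdd (suc a) then 3 + k else 2 + k)       ≡⟨ cong (if_then 3 + k else 2 + k) (isOdd-suc a) ⟩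
      (if not (isOdd a) then 3 + k else 2 + k)       ∎)
    where
    open ≡-Reasoning
    differ : ∀ b → (if b then 3 + k else 2 + k) ≢ (if not b then 3 + k else 2 + k)
    differ true eq = 1+n≢n eq
    differ false eq = 1+n≢n (sym eq)

module Cyclic (k : ℕ) where

  Position : Set
  Position = Fin (suc k)

  next : Position → Position
  next j with toℕ j <? k
  ... | yes j<k = F.suc (fromℕ< j<k)
  ... | no _ = F.zero

  prev : Position → Position
  prev F.zero = fromℕ k
  prev (F.suc i) = inject₁ i

  toℕ-next : ∀ j → toℕ j < k → toℕ (next j) ≡ suc (toℕ j)
  toℕ-next j j<k with toℕ j <? k
  ... | yes _ = cong suc (toℕ-fromℕ< _)
  ... | no j≮k = ⊥-elim (j≮k j<k)

  next-last : ∀ j → ¬ (toℕ j < k) → next j ≡ F.zero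
  next-last j j≮k with toℕ j <? k
  ... | yes j<k = ⊥-elim (j≮k j<k)
  ... | no _ = refl

  prev-next : ∀ j → prev (next j) ≡ j
  prev-next j with toℕ j <? k
  ... | yes j<k = toℕ-injective (trans (toℕ-inject₁ (fromℕ< j<k)) (toℕ-fromℕ< j<k))
  ... | no j≮k = toℕ-injective (trans (toℕ-fromℕ k) (sym (≤∧≮⇒≡ (toℕ≤pred[n] j) j≮k)))

  next-prev : ∀ j → next (prev j) ≡ j
  next-prev F.zero = next-last (fromℕ k) (λ k<k → n≮n k (subst (_< k) (toℕ-fromℕ k) k<k))
  next-prev (F.suc i) = toℕ-injective (trans (toℕ-next (inject₁ i) i<k) (cong suc (toℕ-inject₁ i)))
    where
    i<k : toℕ (inject₁ i) < k
    i<k = subst (_< k) (sym (toℕ-inject₁ i)) (toℕ<n i)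

  rotation : Permutation (suc k) (suc k)
  rotation = permutation next prev next-prev prev-next

  next≢id : 1 ≤ k → ∀ j → next j ≢ j
  next≢id 1≤k j next-j≡j = case toℕ j <? k of λ where
    (yes j<k) → 1+n≢n (trans (sym (toℕ-next j j<k)) (cong toℕ next-j≡j))
    (no j≮k) → j≮k (subst (λ i → toℕ i < k) (trans (sym (next-last j j≮k)) next-j≡j) 1≤k)

  next²≢id : 2 ≤ k → ∀ j → next (next j) ≢ j
  next²≢id 2≤k j eq = case toℕ j <? k of λ where
      (no j≮k) → j≮k (subst (_< k) (toℕ-next²-last j≮k) 2≤k)
      (yes j<k) → case suc (toℕ j) <? k of λ where
        (yes sj<k) → m≢1+n+m (toℕ j) (trans (sym (cong toℕ eq)) (toℕ-next² j<k sj<k))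
        (no sj≮k) → sj≮k (subst (λ i → suc (toℕ i) < k)
          (sym (trans (sym eq) (next-last (next j) (sj≮k ∘ subst (_< k) (toℕ-next j j<k))))) 2≤k)
    where
    toℕ-next² : toℕ j < k → suc (toℕ j) < k → toℕ (next (next j)) ≡ suc (suc (toℕ j))
    toℕ-next² j<k sj<k = trans (toℕ-next (next j) (subst (_< k) (sym (toℕ-next j j<k)) sj<k)) (cong suc (toℕ-next j j<k))
    toℕ-next²-last : ¬ (toℕ j < k) → 1 ≡ toℕ j
    toℕ-next²-last j≮k = trans (sym (toℕ-next F.zero (≤-trans (s≤s z≤n) 2≤k)))
                               (trans (cong (toℕ ∘ next) (sym (next-last j j≮k))) (cong toℕ eq))

module ZigzagPositions (k : ℕ) where
  open Zigzag k
  open Cyclic k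

  zigzagᶠ : Position → Position
  zigzagᶠ j = fromℕ< (s≤s (zigzag-≤ (toℕ j) (toℕ≤pred[n] j)))

  unzigzagᶠ : Position → Position
  unzigzagᶠ v = fromℕ< (s≤s (unzigzag-≤ (toℕ v) (toℕ≤pred[n] v)))

  toℕ-zigzagᶠ : ∀ j → toℕ (zigzagᶠ j) ≡ zigzag (toℕ j)
  toℕ-zigzagᶠ j = toℕ-fromℕ< _

  toℕ-unzigzagᶠ : ∀ v → toℕ (unzigzagᶠ v) ≡ unzigzag (toℕ v)
  toℕ-unzigzagᶠ v = toℕ-fromℕ< _

  zigzagᶠ-unzigzagᶠ : ∀ v → zigzagᶠ (unzigzagᶠ v) ≡ v
  zigzagᶠ-unzigzagᶠ v = toℕ-injective (begin
      toℕ (zigzagᶠ (unzigzagᶠ v))  ≡⟨ toℕ-zigzagᶠ (unzigzagᶠ v) ⟩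
      zigzag (toℕ (unzigzagᶠ v))   ≡⟨ cong zigzag (toℕ-unzigzagᶠ v) ⟩
      zigzag (unzigzag (toℕ v))    ≡⟨ zigzag-unzigzag (toℕ v) (toℕ≤pred[n] v) ⟩
      toℕ v                        ∎)
    where open ≡-Reasoning

  unzigzagᶠ-zigzagᶠ : ∀ j → unzigzagᶠ (zigzagᶠ j) ≡ j
  unzigzagᶠ-zigzagᶠ j = toℕ-injective (begin
      toℕ (unzigzagᶠ (zigzagᶠ j))  ≡⟨ toℕ-unzigzagᶠ (zigzagᶠ j) ⟩
      unzigzag (toℕ (zigzagᶠ j))   ≡⟨ cong unzigzag (toℕ-zigzagᶠ j) ⟩
      unzigzag (zigzag (toℕ j))    ≡⟨ unzigzag-zigzag (toℕ j) (toℕ≤pred[n] j) ⟩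
      toℕ j                        ∎)
    where open ≡-Reasoning

  zigzagPermutation : Permutation (suc k) (suc k)
  zigzagPermutation = permutation zigzagᶠ unzigzagᶠ zigzagᶠ-unzigzagᶠ unzigzagᶠ-zigzagᶠ

  labelAt : Position → ℕ
  labelAt j = suc (toℕ (zigzagᶠ j))

  labelAt+labelAt-prev : ∀ j → labelAt j + labelAt (prev j) ≡ pairSum (toℕ j)
  labelAt+labelAt-prev F.zero =
    cong₂ (λ a b → suc a + suc b) (toℕ-zigzagᶠ F.zero)
          (trans (toℕ-zigzagᶠ (fromℕ k)) (cong zigzag (toℕ-fromℕ k)))
  labelAt+labelAt-prev (F.suc i) =
    cong₂ (λ a b → suc a + suc b) (toℕ-zigzagᶠ (F.suc i))
          (trans (toℕ-zigzagᶠ (inject₁ i)) (cong zigzag (toℕ-inject₁ i)))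

  pairSum-next≢ : 2 ≤ k → ∀ j → pairSum (toℕ j) ≢ pairSum (toℕ (next j))
  pairSum-next≢ 2≤k F.zero eq =
    <⇒≢ (pairSum-zero<suc 2≤k 0 1≤k) (trans eq (cong pairSum (toℕ-next F.zero 1≤k)))
    where 1≤k = ≤-trans (s≤s z≤n) 2≤k
  pairSum-next≢ 2≤k (F.suc i) eq = case suc (toℕ i) <? k of λ where
    (yes si<k) → pairSum-suc≢ (toℕ i) si<k (trans eq (cong pairSum (toℕ-next (F.suc i) si<k)))
    (no si≮k) → <⇒≢ (pairSum-zero<suc 2≤k (toℕ i) (toℕ≤pred[n] (F.suc i)))
                    (sym (trans eq (cong (pairSum ∘ toℕ) (next-last (F.suc i) si≮k))))

  pairSum≤ : 2 ≤ k → ∀ (j : Position) → pairSum (toℕ j) ≤ 3 + k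
  pairSum≤ 2≤k F.zero = ≤-trans (<⇒≤ (pairSum-zero< 2≤k)) (n≤1+n _)
  pairSum≤ 2≤k (F.suc i) = pairSum-suc≤ (toℕ i) (toℕ≤pred[n] (F.suc i))

  pairSum+pairSum≥ : ∀ (i j : Position) → i ≢ j → 4 + k ≤ pairSum (toℕ i) + pairSum (toℕ j)
  pairSum+pairSum≥ F.zero F.zero i≢j = ⊥-elim (i≢j refl)
  pairSum+pairSum≥ F.zero (F.suc j) _ =
    +-mono-≤ (2≤pairSum 0) (pairSum-suc≥ (toℕ j) (toℕ≤pred[n] (F.suc j)))
  pairSum+pairSum≥ (F.suc i) j _ =
    subst (_≤ pairSum (toℕ (F.suc i)) + pairSum (toℕ j)) (+-comm (2 + k) 2)
          (+-mono-≤ (pairSum-suc≥ (toℕ i) (toℕ≤pred[n] (F.suc i))) (2≤pairSum (toℕ j)))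

  pairSum-suc-cases : ∀ (i : Fin k) → pairSum (toℕ (F.suc i)) ≡ 2 + k ⊎ pairSum (toℕ (F.suc i)) ≡ 3 + k
  pairSum-suc-cases i rewrite pairSum-suc (toℕ i) (toℕ≤pred[n] (F.suc i)) with isOdd (toℕ i)
  ... | true = inj₂ refl
  ... | false = inj₁ refl

record EulerTour (G : Graph) : Set where
  field
    k : ℕ
    2≤k : 2 ≤ k
    vertex : Fin (suc k) → Fin (n G)
    edgeAt : Permutation (suc k) (m G)
    edgeAt-joins : ∀ j → SameEdge (ends G (edgeAt ⟨$⟩ʳ j)) (vertex j , vertex (Cyclic.next k j))
    visits-≥1 : ∀ x → 1 ≤ count ((_≟ᶠ x) ∘ vertex) (allFin (suc k))
    visits-≤2 : ∀ x → count ((_≟ᶠ x) ∘ vertex) (allFin (suc k)) ≤ 2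

module TourLabelling (G : Graph) (simple : IsSimple G) (T : EulerTour G) where
  open EulerTour T
  open Zigzag k
  open Cyclic k
  open ZigzagPositions k

  edge : Position → Fin (m G)
  edge = edgeAt ⟨$⟩ʳ_

  labelling : Labeling G
  labelling = ↔⇒⤖ (flip edgeAt ∘ₚ zigzagPermutation ∘ₚ cast-id (↔⇒≡ edgeAt))

  label-edge : ∀ j → label G labelling (edge j) ≡ labelAt j
  label-edge j = cong suc (trans (toℕ-cast _ _) (cong (toℕ ∘ zigzagᶠ) (inverseˡ edgeAt)))

  at : Fin (n G) → Position → Bool
  at x j = ⌊ vertex j ≟ᶠ x ⌋

  visits : Fin (n G) → List Position
  visits x = filter ((_≟ᶠ x) ∘ vertex) (allFin (suc k))

  vertex≢vertex-next : ∀ j → vertex j ≢ vertex (next j)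
  vertex≢vertex-next j eq with edgeAt-joins j
  ... | inj₁ (p , q) = proj₁ simple (edge j) (trans p (trans eq (sym q)))
  ... | inj₂ (p , q) = proj₁ simple (edge j) (trans p (trans (sym eq) (sym q)))

  incident-edge : ∀ x j (h : ℕ) →
    (if ⌊ incident? G x (edge j) ⌋ then h else 0) ≡ (if at x j then h else 0) + (if at x (next j) then h else 0)
  incident-edge x j h with incident? G x (edge j) | vertex j ≟ᶠ x | vertex (next j) ≟ᶠ x | edgeAt-joins j
  ... | _ | yes a | yes b | _ = ⊥-elim (vertex≢vertex-next j (trans a (sym b)))
  ... | yes _ | yes _ | no _ | _ = sym (+-identityʳ h)
  ... | yes _ | no _ | yes _ | _ = refl
  ... | yes (inj₁ p) | no a | no b | inj₁ (q , _) = ⊥-elim (a (trans (sym q) p))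
  ... | yes (inj₁ p) | no a | no b | inj₂ (q , _) = ⊥-elim (b (trans (sym q) p))
  ... | yes (inj₂ p) | no a | no b | inj₁ (_ , q) = ⊥-elim (b (trans (sym q) p))
  ... | yes (inj₂ p) | no a | no b | inj₂ (_ , q) = ⊥-elim (a (trans (sym q) p))
  ... | no ¬inc | yes a | no _ | inj₁ (q , _) = ⊥-elim (¬inc (inj₁ (trans q a)))
  ... | no ¬inc | yes a | no _ | inj₂ (_ , q) = ⊥-elim (¬inc (inj₂ (trans q a)))
  ... | no ¬inc | no _ | yes b | inj₁ (_ , q) = ⊥-elim (¬inc (inj₂ (trans q b)))
  ... | no ¬inc | no _ | yes b | inj₂ (q , _) = ⊥-elim (¬inc (inj₁ (trans q b)))
  ... | no _ | no _ | no _ | _ = refl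

  -- Every edge at x is traversed just before or just after a visit of x.
  sum-incident : ∀ x (ψ : Fin (m G) → ℕ) →
    sum (map (λ e → if ⌊ incident? G x e ⌋ then ψ e else 0) (allFin (m G))) ≡
    sum (map (λ j → ψ (edge j) + ψ (edge (prev j))) (visits x))
  sum-incident x ψ = begin
      sum (map (λ e → if ⌊ incident? G x e ⌋ then ψ e else 0) (allFin (m G)))
    ≡⟨ sum-map-tabulate (λ e → if ⌊ incident? G x e ⌋ then ψ e else 0) (λ e → e) ⟩
      ∑ (λ e → if ⌊ incident? G x e ⌋ then ψ e else 0)
    ≡⟨ sum-permute (λ e → if ⌊ incident? G x e ⌋ then ψ e else 0) edgeAt ⟩
      ∑ (λ j → if ⌊ incident? G x (edge j) ⌋ then ψ (edge j) else 0)
    ≡⟨ sum-cong-≗ (λ j → incident-edge x j (ψ (edge j))) ⟩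
      ∑ (λ j → (if at x j then ψ (edge j) else 0) + (if at x (next j) then ψ (edge j) else 0))
    ≡⟨ ∑-distrib-+ (λ j → if at x j then ψ (edge j) else 0) (λ j → if at x (next j) then ψ (edge j) else 0) ⟩
      ∑ (λ j → if at x j then ψ (edge j) else 0) + ∑ (λ j → if at x (next j) then ψ (edge j) else 0)
    ≡⟨ cong (∑ (λ j → if at x j then ψ (edge j) else 0) +_) after-visit ⟩
      ∑ (λ j → if at x j then ψ (edge j) else 0) + ∑ (λ j → if at x j then ψ (edge (prev j)) else 0)
    ≡⟨ sym (∑-distrib-+ (λ j → if at x j then ψ (edge j) else 0) (λ j → if at x j then ψ (edge (prev j)) else 0)) ⟩
      ∑ (λ j → (if at x j then ψ (edge j) else 0) + (if at x j then ψ (edge (prev j)) else 0))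
    ≡⟨ sum-cong-≗ (λ j → if-+ (at x j) (ψ (edge j)) (ψ (edge (prev j)))) ⟩
      ∑ (λ j → if at x j then ψ (edge j) + ψ (edge (prev j)) else 0)
    ≡⟨ ∑-if≡sum-filter ((_≟ᶠ x) ∘ vertex) (λ j → ψ (edge j) + ψ (edge (prev j))) (λ j → j) ⟩
      sum (map (λ j → ψ (edge j) + ψ (edge (prev j))) (visits x)) ∎
    where
    open ≡-Reasoning
    after-visit : ∑ (λ j → if at x (next j) then ψ (edge j) else 0) ≡ ∑ (λ j → if at x j then ψ (edge (prev j)) else 0)
    after-visit = trans (sum-cong-≗ (λ j → cong (λ i → if at x (next j) then ψ (edge i) else 0) (sym (prev-next j))))
                        (sym (sum-permute (λ j → if at x j then ψ (edge (prev j)) else 0) rotation))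

  weight≡ : ∀ x → weight G labelling x ≡ sum (map (pairSum ∘ toℕ) (visits x))
  weight≡ x = trans (sum-incident x (label G labelling))
    (cong sum (map-cong (λ j → trans (cong₂ _+_ (label-edge j) (label-edge (prev j))) (labelAt+labelAt-prev j)) (visits x)))

  degree≡ : ∀ x → degree G x ≡ length (visits x) ℕ.* 2
  degree≡ x = trans (sum-incident x (λ _ → 1)) (sum-map-const 2 (visits x))

  visitSum : Fin (n G) → ℕ
  visitSum x = sum (map (pairSum ∘ toℕ) (visits x))

  data Visits (x : Fin (n G)) : Set where
    once : ∀ j → visits x ≡ j ∷ [] → Visits x
    twice : ∀ i j → visits x ≡ i ∷ j ∷ [] → i ≢ j → Visits x

  visits-unique : ∀ x → Unique (visits x)
  visits-unique x = filter⁺ ((_≟ᶠ x) ∘ vertex) (allFin⁺ (suc k))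

  visits-shape : ∀ x → Visits x
  visits-shape x with visits x in eq | visits-unique x
  ... | [] | _ = ⊥-elim (1+n≰n (subst (1 ≤_) (cong length eq) (visits-≥1 x)))
  ... | j ∷ [] | _ = once j eq
  ... | i ∷ j ∷ [] | (i≢j ∷ []) ∷ _ = twice i j eq i≢j
  ... | _ ∷ _ ∷ _ ∷ _ | _ = ⊥-elim (case subst (_≤ 2) (cong length eq) (visits-≤2 x) of λ { (s≤s (s≤s ())) })

  ∈visits⇒vertex≡ : ∀ {x j} → j ∈ visits x → vertex j ≡ x
  ∈visits⇒vertex≡ = proj₂ ∘ ∈-filter⁻ ((_≟ᶠ _) ∘ vertex)

  vertex≡⇒∈visits : ∀ {x} j → vertex j ≡ x → j ∈ visits x
  vertex≡⇒∈visits j = ∈-filter⁺ ((_≟ᶠ _) ∘ vertex) (∈-allFin j)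

  visited-once : ∀ {x i} j → visits x ≡ i ∷ [] → vertex j ≡ x → j ≡ i
  visited-once j eq vj≡x with subst (j ∈_) eq (vertex≡⇒∈visits j vj≡x)
  ... | here j≡i = j≡i

  visitSum-once : ∀ {x j} → visits x ≡ j ∷ [] → visitSum x ≡ pairSum (toℕ j)
  visitSum-once eq = trans (cong (sum ∘ map (pairSum ∘ toℕ)) eq) (+-identityʳ _)

  visitSum-twice : ∀ {x i j} → visits x ≡ i ∷ j ∷ [] → visitSum x ≡ pairSum (toℕ i) + pairSum (toℕ j)
  visitSum-twice {i = i} {j} eq =
    trans (cong (sum ∘ map (pairSum ∘ toℕ)) eq) (cong (pairSum (toℕ i) +_) (+-identityʳ (pairSum (toℕ j))))

  degree-twice : ∀ {x i j} → visits x ≡ i ∷ j ∷ [] → degree G x ≡ 4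
  degree-twice {x} eq = trans (degree≡ x) (cong (λ l → length l ℕ.* 2) eq)

  visitSum-once<twice : ∀ {x y a b c} → visits x ≡ a ∷ [] → visits y ≡ b ∷ c ∷ [] → b ≢ c →
                        visitSum x < visitSum y
  visitSum-once<twice {a = a} {b} {c} ex ey b≢c = begin-strict
      visitSum _                        ≡⟨ visitSum-once ex ⟩
      pairSum (toℕ a)                   <⟨ s≤s (pairSum≤ 2≤k a) ⟩
      4 + k                             ≤⟨ pairSum+pairSum≥ b c b≢c ⟩
      pairSum (toℕ b) + pairSum (toℕ c) ≡⟨ sym (visitSum-twice ey) ⟩
      visitSum _                        ∎
    where open ≤-Reasoning

  visitSum-next≢ : ∀ j → ¬ (degree G (vertex j) ≡ 4 × degree G (vertex (next j)) ≡ 4) →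
                   visitSum (vertex j) ≢ visitSum (vertex (next j))
  visitSum-next≢ j ¬both4 with visits-shape (vertex j) | visits-shape (vertex (next j))
  ... | once a ea | once b eb = λ eq → pairSum-next≢ 2≤k j (begin
      pairSum (toℕ j)          ≡⟨ cong (pairSum ∘ toℕ) (visited-once j ea refl) ⟩
      pairSum (toℕ a)          ≡⟨ sym (visitSum-once ea) ⟩
      visitSum (vertex j)      ≡⟨ eq ⟩
      visitSum (vertex (next j)) ≡⟨ visitSum-once eb ⟩
      pairSum (toℕ b)          ≡⟨ cong (pairSum ∘ toℕ) (sym (visited-once (next j) eb refl)) ⟩
      pairSum (toℕ (next j))   ∎)
    where open ≡-Reasoning
  ... | once _ ea | twice _ _ eb b≢c = <⇒≢ (visitSum-once<twice ea eb b≢c)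
  ... | twice _ _ ea a≢a′ | once _ eb = ≢-sym (<⇒≢ (visitSum-once<twice eb ea a≢a′))
  ... | twice _ _ ea _ | twice _ _ eb _ = ⊥-elim (¬both4 (degree-twice ea , degree-twice eb))

  weightValues : List ℕ
  weightValues = 2 + k ∷ 3 + k ∷ (2 + k) + (2 + k) ∷ (2 + k) + (3 + k) ∷ (3 + k) + (3 + k)
               ∷ visitSum (vertex F.zero) ∷ []

  at-start : ∀ {x} → vertex F.zero ≡ x → visitSum x ∈ weightValues
  at-start refl = there (there (there (there (there (here refl)))))

  visitSum∈weightValues : ∀ x → visitSum x ∈ weightValues
  visitSum∈weightValues x with visits-shape x
  ... | once F.zero e = at-start (∈visits⇒vertex≡ (subst (F.zero ∈_) (sym e) (here refl)))
  ... | twice F.zero _ e _ = at-start (∈visits⇒vertex≡ (subst (F.zero ∈_) (sym e) (here refl)))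
  ... | twice (F.suc _) F.zero e _ = at-start (∈visits⇒vertex≡ (subst (F.zero ∈_) (sym e) (there (here refl))))
  ... | once (F.suc i) e with pairSum-suc-cases i
  ...   | inj₁ p = here (trans (visitSum-once e) p)
  ...   | inj₂ p = there (here (trans (visitSum-once e) p))
  visitSum∈weightValues x | twice (F.suc i) (F.suc j) e _ with pairSum-suc-cases i | pairSum-suc-cases j
  ...   | inj₁ p | inj₁ q = there (there (here (trans (visitSum-twice e) (cong₂ _+_ p q))))
  ...   | inj₁ p | inj₂ q = there (there (there (here (trans (visitSum-twice e) (cong₂ _+_ p q)))))
  ...   | inj₂ p | inj₁ q =
    there (there (there (here (trans (visitSum-twice e) (trans (+-comm (pairSum (toℕ (F.suc i))) _) (cong₂ _+_ q p))))))
  ...   | inj₂ p | inj₂ q = there (there (there (there (here (trans (visitSum-twice e) (cong₂ _+_ p q))))))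

  numWeights≤6 : numWeights G labelling ≤ 6
  numWeights≤6 = length-≤-⊆ (deduplicate-! (map (weight G labelling) (allFin (n G)))) weight∈
    where
    weight∈ : ∀ {w} → w ∈ deduplicate ℕ._≟_ (map (weight G labelling) (allFin (n G))) → w ∈ weightValues
    weight∈ w∈ with x , _ , refl ← ∈-map⁻ (weight G labelling) (∈-deduplicate⁻ ℕ._≟_ _ w∈) =
      subst (_∈ weightValues) (sym (weight≡ x)) (visitSum∈weightValues x)

  joins-consecutive : ∀ {x y} j → SameEdge (ends G (edge j)) (x , y) →
    (x ≡ vertex j × y ≡ vertex (next j)) ⊎ (x ≡ vertex (next j) × y ≡ vertex j)
  joins-consecutive j xy with edgeAt-joins j | xy
  ... | inj₁ (p₁ , p₂) | inj₁ (q₁ , q₂) = inj₁ (trans (sym q₁) p₁ , trans (sym q₂) p₂)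
  ... | inj₁ (p₁ , p₂) | inj₂ (q₁ , q₂) = inj₂ (trans (sym q₂) p₂ , trans (sym q₁) p₁)
  ... | inj₂ (p₁ , p₂) | inj₁ (q₁ , q₂) = inj₂ (trans (sym q₁) p₁ , trans (sym q₂) p₂)
  ... | inj₂ (p₁ , p₂) | inj₂ (q₁ , q₂) = inj₁ (trans (sym q₂) p₂ , trans (sym q₁) p₁)

  labelling-localAntimagic : (∀ x y → Adjacent G x y → ¬ (degree G x ≡ 4 × degree G y ≡ 4)) →
                             IsLocalAntimagic G labelling
  labelling-localAntimagic no44 x y (e , xy) wx≡wy
    with joins-consecutive (edgeAt ⟨$⟩ˡ e) (subst (λ e′ → SameEdge (ends G e′) (x , y)) (sym (inverseʳ edgeAt)) xy)
  ... | inj₁ (refl , refl) =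
    visitSum-next≢ _ (no44 x y (e , xy)) (trans (sym (weight≡ x)) (trans wx≡wy (weight≡ y)))
  ... | inj₂ (refl , refl) =
    visitSum-next≢ _ (λ (d₁ , d₂) → no44 x y (e , xy) (d₂ , d₁))
                     (trans (sym (weight≡ y)) (trans (sym wx≡wy) (weight≡ x)))

  χla≤6 : (∀ x y → Adjacent G x y → ¬ (degree G x ≡ 4 × degree G y ≡ 4)) → χla≤ G 6
  χla≤6 no44 = labelling , labelling-localAntimagic no44 , numWeights≤6

-- Closed walks as vertex lists

module _ {A : Set} where

  path : List A → List (A × A)
  path [] = []
  path (x ∷ []) = []
  path (x ∷ y ∷ s) = (x , y) ∷ path (y ∷ s)

  lastOr : A → List A → A
  lastOr y [] = y
  lastOr y (z ∷ s) = lastOr z s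

  -- Defs keeps the helper behind cycleEdges private: dropping the first pair of
  -- cycleEdges (f ∷ l) gives the walk along l followed by a closing step back to f.
  walkBackTo : A → List A → List (A × A)
  walkBackTo f l = L.drop 1 (cycleEdges (f ∷ l))

  walkBackTo-∷ : ∀ f y s → walkBackTo f (y ∷ s) ≡ path (y ∷ s) ++ [ (lastOr y s , f) ]
  walkBackTo-∷ f y [] = refl
  walkBackTo-∷ f y (z ∷ s) = cong ((y , z) ∷_) (walkBackTo-∷ f z s)

  cycleEdges-∷ : ∀ y s → cycleEdges (y ∷ s) ≡ path (y ∷ s) ++ [ (lastOr y s , y) ]
  cycleEdges-∷ y s = walkBackTo-∷ y y s

  path-++ : ∀ y s z u → path ((y ∷ s) ++ (z ∷ u)) ≡ path (y ∷ s) ++ (lastOr y s , z) ∷ path (z ∷ u)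
  path-++ y [] z u = refl
  path-++ y (x ∷ s) z u = cong ((y , x) ∷_) (path-++ x s z u)

  lastOr-++ : ∀ y s z u → lastOr y (s ++ z ∷ u) ≡ lastOr z u
  lastOr-++ y [] z u = refl
  lastOr-++ y (x ∷ s) z u = lastOr-++ x s z u

  cycleEdges-++ : ∀ y s z u → cycleEdges ((y ∷ s) ++ (z ∷ u)) ≡
    (path (y ∷ s) ++ [ (lastOr y s , z) ]) ++ (path (z ∷ u) ++ [ (lastOr z u , y) ])
  cycleEdges-++ y s z u = begin
      cycleEdges ((y ∷ s) ++ (z ∷ u))
    ≡⟨ cycleEdges-∷ y (s ++ z ∷ u) ⟩
      path ((y ∷ s) ++ (z ∷ u)) ++ [ (lastOr y (s ++ z ∷ u) , y) ]
    ≡⟨ cong₂ (λ p l → p ++ [ (l , y) ]) (path-++ y s z u) (lastOr-++ y s z u) ⟩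
      (path (y ∷ s) ++ (lastOr y s , z) ∷ path (z ∷ u)) ++ [ (lastOr z u , y) ]
    ≡⟨ ++-assoc (path (y ∷ s)) _ _ ⟩
      path (y ∷ s) ++ (lastOr y s , z) ∷ (path (z ∷ u) ++ [ (lastOr z u , y) ])
    ≡⟨ sym (++-assoc (path (y ∷ s)) _ _) ⟩
      (path (y ∷ s) ++ [ (lastOr y s , z) ]) ++ (path (z ∷ u) ++ [ (lastOr z u , y) ]) ∎
    where open ≡-Reasoning

  cycleEdges-rotate : ∀ a b → cycleEdges (a ++ b) ↭ cycleEdges (b ++ a)
  cycleEdges-rotate [] b = ↭-reflexive (cong cycleEdges (sym (++-identityʳ b)))
  cycleEdges-rotate (y ∷ s) [] = ↭-reflexive (cong cycleEdges (++-identityʳ (y ∷ s)))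
  cycleEdges-rotate (y ∷ s) (z ∷ u) = begin
      cycleEdges ((y ∷ s) ++ (z ∷ u))  ≡⟨ cycleEdges-++ y s z u ⟩
      yz ++ zy                         ↭⟨ ++-comm yz zy ⟩
      zy ++ yz                         ≡⟨ sym (cycleEdges-++ z u y s) ⟩
      cycleEdges ((z ∷ u) ++ (y ∷ s))  ∎
    where
    open PermutationReasoning
    yz = path (y ∷ s) ++ [ (lastOr y s , z) ]
    zy = path (z ∷ u) ++ [ (lastOr z u , y) ]

  cycleEdges-figureEight : ∀ w q b → cycleEdges ((w ∷ q) ++ (w ∷ b)) ≡ cycleEdges (w ∷ q) ++ cycleEdges (w ∷ b)
  cycleEdges-figureEight w q b = trans (cycleEdges-++ w q w b) (sym (cong₂ _++_ (cycleEdges-∷ w q) (cycleEdges-∷ w b)))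

  -- Inserting the closed walk a′ ++ w ∷ b′, rotated to start at w, into a ++ w ∷ b at w.
  splice : A → List A → List A → List A → List A → List A
  splice w a b a′ b′ = a ++ (w ∷ b′ ++ a′) ++ (w ∷ b)

  splice-↭ : ∀ w a b a′ b′ → splice w a b a′ b′ ↭ (a′ ++ w ∷ b′) ++ (a ++ w ∷ b)
  splice-↭ w a b a′ b′ = begin
      a ++ (w ∷ b′ ++ a′) ++ (w ∷ b)   ↭⟨ ++-comm a _ ⟩
      ((w ∷ b′ ++ a′) ++ (w ∷ b)) ++ a ≡⟨ ++-assoc (w ∷ b′ ++ a′) (w ∷ b) a ⟩
      (w ∷ b′ ++ a′) ++ (w ∷ b ++ a)  ↭⟨ ++⁺ (++-comm (w ∷ b′) a′) (++-comm (w ∷ b) a) ⟩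
      (a′ ++ w ∷ b′) ++ (a ++ w ∷ b)  ∎
    where open PermutationReasoning

  splice-cycleEdges : ∀ w a b a′ b′ →
    cycleEdges (splice w a b a′ b′) ↭ cycleEdges (a′ ++ w ∷ b′) ++ cycleEdges (a ++ w ∷ b)
  splice-cycleEdges w a b a′ b′ = begin
      cycleEdges (a ++ (w ∷ b′ ++ a′) ++ (w ∷ b))           ↭⟨ cycleEdges-rotate a _ ⟩
      cycleEdges (((w ∷ b′ ++ a′) ++ (w ∷ b)) ++ a)         ≡⟨ cong cycleEdges (++-assoc (w ∷ b′ ++ a′) (w ∷ b) a) ⟩
      cycleEdges ((w ∷ b′ ++ a′) ++ (w ∷ b ++ a))           ≡⟨ cycleEdges-figureEight w (b′ ++ a′) (b ++ a) ⟩
      cycleEdges (w ∷ b′ ++ a′) ++ cycleEdges (w ∷ b ++ a)  ↭⟨ ++⁺ (cycleEdges-rotate (w ∷ b′) a′) (cycleEdges-rotate (w ∷ b) a) ⟩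
      cycleEdges (a′ ++ w ∷ b′) ++ cycleEdges (a ++ w ∷ b)  ∎
    where open PermutationReasoning

  data Chain : List (List A) → Set where
    single : ∀ C → Chain (C ∷ [])
    link : ∀ {C D cs} w → w ∈ C → w ∈ D → Chain (D ∷ cs) → Chain (C ∷ D ∷ cs)

  chain-tour : ∀ {cs} → Chain cs → ∃[ L ] (L ↭ concat cs × cycleEdges L ↭ concat (map cycleEdges cs))
  chain-tour (single C) = C , ↭-reflexive (sym (++-identityʳ C)) , ↭-reflexive (sym (++-identityʳ (cycleEdges C)))
  chain-tour (link {C} {D} {cs} w w∈C w∈D chain)
    with W , W↭ , W-edges ← chain-tour chain
    with a , b , refl ← ∈-∃++ w∈C
    with a′ , b′ , refl ← ∈-∃++ (∈-resp-↭ (↭-sym W↭) (∈-++⁺ˡ w∈D)) =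
    splice w a b a′ b′ ,
    ↭-trans (splice-↭ w a b a′ b′) (↭-trans (++⁺ʳ _ W↭) (++-comm (concat (D ∷ cs)) _)) ,
    ↭-trans (splice-cycleEdges w a b a′ b′) (↭-trans (++⁺ʳ _ W-edges) (++-comm (concat (map cycleEdges (D ∷ cs))) _))

  chain-tabulate : ∀ t (c : Fin (suc t) → List A) → (∀ i → ∃[ w ] (w ∈ c (inject₁ i) × w ∈ c (F.suc i))) →
                   Chain (tabulate c)
  chain-tabulate zero c _ = single (c F.zero)
  chain-tabulate (suc t) c shared with w , w∈c₀ , w∈c₁ ← shared F.zero =
    link w w∈c₀ w∈c₁ (chain-tabulate t (c ∘ F.suc) (shared ∘ F.suc))

  nthOr : A → List A → ℕ → A
  nthOr d [] _ = d
  nthOr d (x ∷ xs) zero = x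
  nthOr d (x ∷ xs) (suc i) = nthOr d xs i

  nthOr-length : ∀ d xs → nthOr d xs (length xs) ≡ d
  nthOr-length d [] = refl
  nthOr-length d (x ∷ xs) = nthOr-length d xs

  walkBackTo-tabulate : ∀ f y s → walkBackTo f (y ∷ s) ≡
    tabulate {n = suc (length s)} (λ j → (nthOr f (y ∷ s) (toℕ j) , nthOr f (y ∷ s) (suc (toℕ j))))
  walkBackTo-tabulate f y [] = refl
  walkBackTo-tabulate f y (z ∷ s) = cong ((y , z) ∷_) (walkBackTo-tabulate f z s)

  ∷-tabulate : ∀ f y s → y ∷ s ≡ tabulate {n = suc (length s)} (λ j → nthOr f (y ∷ s) (toℕ j))
  ∷-tabulate f y [] = refl
  ∷-tabulate f y (z ∷ s) = cong (y ∷_) (∷-tabulate f z s)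

module ClosedWalk {A : Set} (x₀ : A) (r : List A) where
  open Cyclic (length r)

  walk : List A
  walk = x₀ ∷ r

  vertex : Position → A
  vertex j = nthOr x₀ walk (toℕ j)

  step : Position → A × A
  step j = (vertex j , vertex (next j))

  nthOr-suc : ∀ j → nthOr x₀ walk (suc (toℕ j)) ≡ vertex (next j)
  nthOr-suc j = case toℕ j <? length r of λ where
    (yes j<k) → cong (nthOr x₀ walk) (sym (toℕ-next j j<k))
    (no j≮k) → trans (cong (nthOr x₀ walk ∘ suc) (≤∧≮⇒≡ (toℕ≤pred[n] j) j≮k))
                     (trans (nthOr-length x₀ walk) (cong vertex (sym (next-last j j≮k))))

  walk≡tabulate : walk ≡ tabulate vertex
  walk≡tabulate = ∷-tabulate x₀ x₀ r

  cycleEdges≡tabulate : cycleEdges walk ≡ tabulate step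
  cycleEdges≡tabulate = trans (walkBackTo-tabulate x₀ x₀ r) (tabulate-cong (λ j → cong (vertex j ,_) (nthOr-suc j)))

module _ {A : Set} where

  SameEdge-sym : ∀ {p q : A × A} → SameEdge p q → SameEdge q p
  SameEdge-sym (inj₁ (a , b)) = inj₁ (sym a , sym b)
  SameEdge-sym (inj₂ (a , b)) = inj₂ (sym b , sym a)

  SameEdge-trans : ∀ {p q r : A × A} → SameEdge p q → SameEdge q r → SameEdge p r
  SameEdge-trans (inj₁ (a , b)) (inj₁ (c , d)) = inj₁ (trans a c , trans b d)
  SameEdge-trans (inj₁ (a , b)) (inj₂ (c , d)) = inj₂ (trans a c , trans b d)
  SameEdge-trans (inj₂ (a , b)) (inj₁ (c , d)) = inj₂ (trans a d , trans b c)
  SameEdge-trans (inj₂ (a , b)) (inj₂ (c , d)) = inj₁ (trans a d , trans b c)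

sameEdge? : ∀ {k} (p q : Fin k × Fin k) → Dec (SameEdge p q)
sameEdge? (a , b) (c , d) = ((a ≟ᶠ c) ×-dec (b ≟ᶠ d)) ⊎-dec ((a ≟ᶠ d) ×-dec (b ≟ᶠ c))

module CycleWalk {N} (y : Fin N) (s : List (Fin N)) (c! : Unique (y ∷ s)) (2≤k : 2 ≤ length s) where
  open ClosedWalk y s
  open Cyclic (length s)

  vertex-injective : ∀ {i j} → vertex i ≡ vertex j → i ≡ j
  vertex-injective {i} {j} eq = count≤1⇒tabulate-injective (_≟ᶠ vertex i) vertex
    (subst (λ l → count (_≟ᶠ vertex i) l ≤ 1) walk≡tabulate (unique⇒count≤1 c! (vertex i))) i j refl (sym eq)

  step-injective : ∀ {i j} → SameEdge (step i) (step j) → i ≡ j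
  step-injective (inj₁ (eq , _)) = vertex-injective eq
  step-injective {i} {j} (inj₂ (i≡nj , ni≡j)) =
    ⊥-elim (next²≢id 2≤k j (trans (cong next (sym (vertex-injective i≡nj))) (vertex-injective ni≡j)))

  vertex∈walk : ∀ j → vertex j ∈ walk
  vertex∈walk j = subst (vertex j ∈_) (sym walk≡tabulate) (∈-tabulate⁺ {f = vertex} j)

  steps-endpoints : ∀ {p} → p ∈ cycleEdges walk → proj₁ p ∈ walk × proj₂ p ∈ walk × proj₁ p ≢ proj₂ p
  steps-endpoints p∈ with ∈-tabulate⁻ {f = step} (subst (_ ∈_) cycleEdges≡tabulate p∈)
  ... | j , refl =
    vertex∈walk j , vertex∈walk (next j) , λ eq → next≢id (≤-trans (s≤s z≤n) 2≤k) j (sym (vertex-injective eq))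

  steps-once : ∀ p → count (sameEdge? p) (cycleEdges walk) ≤ 1
  steps-once p = begin
      count (sameEdge? p) (cycleEdges walk)   ≡⟨ cong (count (sameEdge? p)) cycleEdges≡tabulate ⟩
      count (sameEdge? p) (tabulate step)     ≡⟨ count-tabulate (sameEdge? p) step ⟩
      count (sameEdge? p ∘ step) (allFin _)   ≤⟨ count≤1 (sameEdge? p ∘ step) (allFin⁺ _) same ⟩
      1                                       ∎
    where
    open ≤-Reasoning
    same : ∀ {a b} → a ∈ allFin _ → b ∈ allFin _ → SameEdge p (step a) → SameEdge p (step b) → a ≡ b
    same _ _ pa pb = step-injective (SameEdge-trans (SameEdge-sym pa) pb)

cycle-steps-endpoints : ∀ {N} {c : List (Fin N)} → IsCycle c → ∀ {p} → p ∈ cycleEdges c →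
                        proj₁ p ∈ c × proj₂ p ∈ c × proj₁ p ≢ proj₂ p
cycle-steps-endpoints {c = y ∷ s} (c! , s≤s 2≤k) = CycleWalk.steps-endpoints y s c! 2≤k

cycle-steps-once : ∀ {N} {c : List (Fin N)} → IsCycle c → ∀ p → count (sameEdge? p) (cycleEdges c) ≤ 1
cycle-steps-once {c = y ∷ s} (c! , s≤s 2≤k) = CycleWalk.steps-once y s c! 2≤k

record IsEulerWalk (G : Graph) (L : List (Fin (n G))) : Set where
  field
    3≤length : 3 ≤ length L
    steps⊆edges : ∀ p → p ∈ cycleEdges L → ∃[ e ] SameEdge (ends G e) p
    edges⊆steps : ∀ e → Any (SameEdge (ends G e)) (cycleEdges L)
    steps-once : ∀ p → count (sameEdge? p) (cycleEdges L) ≤ 1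
    visits-≥1 : ∀ x → 1 ≤ count (_≟ᶠ x) L
    visits-≤2 : ∀ x → count (_≟ᶠ x) L ≤ 2

module _ (G : Graph) (simple : IsSimple G) (x₀ : Fin (n G)) (r : List (Fin (n G))) (W : IsEulerWalk G (x₀ ∷ r)) where
  open IsEulerWalk W
  open ClosedWalk x₀ r
  open Cyclic (length r)

  private
    stepEdge : ∀ j → ∃[ e ] SameEdge (ends G e) (step j)
    stepEdge j = steps⊆edges (step j) (subst (step j ∈_) (sym cycleEdges≡tabulate) (∈-tabulate⁺ {f = step} j))

    edgeStep : ∀ e → ∃[ j ] SameEdge (ends G e) (step j)
    edgeStep e = Any-tabulate⁻ (subst (Any (SameEdge (ends G e))) cycleEdges≡tabulate (edges⊆steps e))

    step-injective : ∀ i j → SameEdge (step i) (step j) → i ≡ j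
    step-injective i j = count≤1⇒tabulate-injective (sameEdge? (step i)) step
      (subst (λ l → count (sameEdge? (step i)) l ≤ 1) cycleEdges≡tabulate (steps-once (step i))) i j (inj₁ (refl , refl))

    edge : Position → Fin (m G)
    edge = proj₁ ∘ stepEdge

    position : Fin (m G) → Position
    position = proj₁ ∘ edgeStep

    edge-position : ∀ e → edge (position e) ≡ e
    edge-position e = sym (proj₂ simple e (edge (position e))
      (SameEdge-trans (proj₂ (edgeStep e)) (SameEdge-sym (proj₂ (stepEdge (position e))))))

    position-edge : ∀ j → position (edge j) ≡ j
    position-edge j = step-injective _ j (SameEdge-trans (SameEdge-sym (proj₂ (edgeStep (edge j)))) (proj₂ (stepEdge j)))

    visits≡ : ∀ x → count (_≟ᶠ x) (x₀ ∷ r) ≡ count ((_≟ᶠ x) ∘ vertex) (allFin (suc (length r)))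
    visits≡ x = trans (cong (count (_≟ᶠ x)) walk≡tabulate) (count-tabulate (_≟ᶠ x) vertex)

  eulerWalk⇒EulerTour : EulerTour G
  eulerWalk⇒EulerTour = record
    { k = length r
    ; 2≤k = ≤-pred 3≤length
    ; vertex = vertex
    ; edgeAt = permutation edge position edge-position position-edge
    ; edgeAt-joins = proj₂ ∘ stepEdge
    ; visits-≥1 = λ x → subst (1 ≤_) (visits≡ x) (visits-≥1 x)
    ; visits-≤2 = λ x → subst (_≤ 2) (visits≡ x) (visits-≤2 x)
    }

euler-tour : ∀ {G} → IsSimple G → ∀ {L} → IsEulerWalk G L → EulerTour G
euler-tour {G} simple {x₀ ∷ r} W = eulerWalk⇒EulerTour G simple x₀ r W
euler-tour simple {[]} W = case IsEulerWalk.3≤length W of λ ()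

-- Necklaces

module NecklaceWalk {G : Graph} {u v : Fin (n G)} {t : ℕ} (N : IsNecklace G u v (suc t)) where
  open IsNecklace N

  private
    tour : ∃[ L ] (L ↭ concat (tabulate cyc) × cycleEdges L ↭ concat (map cycleEdges (tabulate cyc)))
    tour = chain-tour (chain-tabulate t cyc shared)
      where
      shared : ∀ i → ∃[ w ] (w ∈ cyc (inject₁ i) × w ∈ cyc (F.suc i))
      shared i with w , w∈ , w∈′ , _ ← consecutive (inject₁ i) (F.suc i) (cong suc (sym (toℕ-inject₁ i))) =
        w , w∈ , w∈′

    L : List (Fin (n G))
    L = proj₁ tour

    L↭ : L ↭ concat (tabulate cyc)
    L↭ = proj₁ (proj₂ tour)

    edges↭ : cycleEdges L ↭ concat (tabulate (cycleEdges ∘ cyc))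
    edges↭ = subst (cycleEdges L ↭_) (cong concat (map-tabulate cyc cycleEdges)) (proj₂ (proj₂ tour))

    cycles-adjacent : ∀ {x} i j → x ∈ cyc i → x ∈ cyc j → i ≢ j → Consecutive (toℕ i) (toℕ j)
    cycles-adjacent i j x∈i x∈j i≢j with <-cmp (toℕ i) (toℕ j)
    ... | tri≈ _ i≡j _ = ⊥-elim (i≢j (toℕ-injective i≡j))
    ... | tri< i<j _ _ with m≤n⇒m<n∨m≡n i<j
    ...   | inj₁ i+1<j = ⊥-elim (nonconsec i j i+1<j _ x∈i x∈j)
    ...   | inj₂ i+1≡j = inj₁ (sym i+1≡j)
    cycles-adjacent i j x∈i x∈j i≢j | tri> _ _ j<i with m≤n⇒m<n∨m≡n j<i
    ...   | inj₁ j+1<i = ⊥-elim (nonconsec j i j+1<i _ x∈j x∈i)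
    ...   | inj₂ j+1≡i = inj₂ (sym j+1≡i)

    cycles-sharing-two-vertices : ∀ {a b} i j → a ∈ cyc i → b ∈ cyc i → a ∈ cyc j → b ∈ cyc j → a ≢ b → i ≡ j
    cycles-sharing-two-vertices i j a∈i b∈i a∈j b∈j a≢b with i ≟ᶠ j
    ... | yes i≡j = i≡j
    ... | no i≢j with cycles-adjacent i j a∈i a∈j i≢j
    ...   | inj₁ j≡i+1 with _ , _ , _ , only ← consecutive i j j≡i+1 =
      ⊥-elim (a≢b (trans (only _ a∈i a∈j) (sym (only _ b∈i b∈j))))
    ...   | inj₂ i≡j+1 with _ , _ , _ , only ← consecutive j i i≡j+1 =
      ⊥-elim (a≢b (trans (only _ a∈j a∈i) (sym (only _ b∈j b∈i))))

    visits-cycle : Fin (n G) → Fin (suc t) → ℕ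
    visits-cycle x i = count (_≟ᶠ x) (cyc i)

    visits≡∑ : ∀ x → count (_≟ᶠ x) L ≡ ∑ (visits-cycle x)
    visits≡∑ x = trans (count-↭ (_≟ᶠ x) L↭) (count-concat-tabulate (_≟ᶠ x) cyc)

    steps-cycle : Fin (n G) × Fin (n G) → Fin (suc t) → ℕ
    steps-cycle p i = count (sameEdge? p) (cycleEdges (cyc i))

    steps≡∑ : ∀ p → count (sameEdge? p) (cycleEdges L) ≡ ∑ (steps-cycle p)
    steps≡∑ p = trans (count-↭ (sameEdge? p) edges↭) (count-concat-tabulate (sameEdge? p) (cycleEdges ∘ cyc))

    ∈cycle : ∀ {x} i → 1 ≤ visits-cycle x i → x ∈ cyc i
    ∈cycle {x} i 1≤c with count>0⇒∈ (_≟ᶠ x) (cyc i) 1≤c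
    ... | _ , x∈ , refl = x∈

    steps-in-one-cycle : ∀ p i j → 1 ≤ steps-cycle p i → 1 ≤ steps-cycle p j → i ≡ j
    steps-in-one-cycle p i j ci cj
      with q , q∈i , pq ← count>0⇒∈ (sameEdge? p) _ ci
      with q′ , q′∈j , pq′ ← count>0⇒∈ (sameEdge? p) _ cj
      with a∈i , b∈i , a≢b ← cycle-steps-endpoints (isCycle i) q∈i
      with a∈j , b∈j , _ ← cycle-steps-endpoints (isCycle j) q′∈j
      with SameEdge-trans (SameEdge-sym pq) pq′
    ... | inj₁ (a≡ , b≡) =
      cycles-sharing-two-vertices i j a∈i b∈i (subst (_∈ cyc j) (sym a≡) a∈j) (subst (_∈ cyc j) (sym b≡) b∈j) a≢b
    ... | inj₂ (a≡ , b≡) =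
      cycles-sharing-two-vertices i j a∈i b∈i (subst (_∈ cyc j) (sym a≡) b∈j) (subst (_∈ cyc j) (sym b≡) a∈j) a≢b

    3≤length : 3 ≤ length L
    3≤length = begin
      3                                ≤⟨ proj₂ (isCycle F.zero) ⟩
      length (cyc F.zero)              ≤⟨ length-++-≤ˡ (cyc F.zero) ⟩
      length (concat (tabulate cyc))   ≡⟨ sym (↭-length L↭) ⟩
      length L                         ∎
      where open ≤-Reasoning

    steps⊆edges : ∀ p → p ∈ cycleEdges L → ∃[ e ] SameEdge (ends G e) p
    steps⊆edges p p∈ with i , p∈i ← Any-tabulate⁻ {f = cycleEdges ∘ cyc} (Any-concat⁻ _ (∈-resp-↭ edges↭ p∈)) =
      cycleEdgesInG i p p∈i

    edges⊆steps : ∀ e → Any (SameEdge (ends G e)) (cycleEdges L)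
    edges⊆steps e with i , e∈i ← edgesCovered e =
      Any-resp-↭ (↭-sym edges↭) (Any-concat⁺ (Any-tabulate⁺ {f = cycleEdges ∘ cyc} i e∈i))

    steps-once : ∀ p → count (sameEdge? p) (cycleEdges L) ≤ 1
    steps-once p = subst (_≤ 1) (sym (steps≡∑ p))
      (∑≤1 (steps-cycle p) (λ i → cycle-steps-once (isCycle i) p) (steps-in-one-cycle p))

    visits-≥1 : ∀ x → 1 ≤ count (_≟ᶠ x) L
    visits-≥1 x with i , x∈i ← vertsCovered x =
      subst (1 ≤_) (sym (visits≡∑ x)) (≤-trans (∈⇒count>0 (_≟ᶠ x) x∈i refl) (term≤∑ (visits-cycle x) i))

    visits-≤2 : ∀ x → count (_≟ᶠ x) L ≤ 2
    visits-≤2 x = subst (_≤ 2) (sym (visits≡∑ x))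
      (∑≤2 (visits-cycle x) (λ i → unique⇒count≤1 (proj₁ (isCycle i)) x)
        λ i j l ci cj cl i≢j j≢l i≢l → no-consecutive-triangle
          (cycles-adjacent i j (∈cycle i ci) (∈cycle j cj) i≢j)
          (cycles-adjacent j l (∈cycle j cj) (∈cycle l cl) j≢l)
          (cycles-adjacent i l (∈cycle i ci) (∈cycle l cl) i≢l))

  necklace-eulerWalk : ∃[ L ] IsEulerWalk G L
  necklace-eulerWalk = L , record
    { 3≤length = 3≤length
    ; steps⊆edges = steps⊆edges
    ; edges⊆steps = edges⊆steps
    ; steps-once = steps-once
    ; visits-≥1 = visits-≥1
    ; visits-≤2 = visits-≤2
    }

mainTheorem12 : (G : Graph) → IsSimple G → (u v : Fin (n G)) → (t : ℕ) → 2 ≤ t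
              → IsNecklace G u v t
              → (∀ x y → Adjacent G x y → ¬ (degree G x ≡ 4 × degree G y ≡ 4))
              → χla≤ G 6
mainTheorem12 G simple u v (suc t) _ necklace no-adjacent-4s =
  TourLabelling.χla≤6 G simple (euler-tour simple (proj₂ necklace-eulerWalk)) no-adjacent-4s
  where open NecklaceWalk necklace
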